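{- Let $D$ be a diagram containing no ghost cells, i.e. $|G(D)|=0$, and let $M=\max\{|G(T)| : T\in \mathrm{GKD}(D)\}$. Then the ghost Kohnert poset $\mathcal{P}_G(D)$ is ranked, and the function $\rho(T)=M-|G(T)|$ for $T\in\mathcal{P}_G(D)$ is a rank function for it.
   Context: A diagram is a finite set of cells placed at positions $(r,c)\in\mathbb{Z}_{>0}\times\mathbb{Z}_{>0}$ ($r$ the row, counted from the bottom; $c$ the column), each position holding at most one cell; each cell is either an ordinary cell, written $(r,c)$, or a ghost cell, written $\langle r,c\rangle$. A position is empty if it holds no cell of either kind. $G(D)$ denotes the set of ghost cells of $D$. The ghost move at row $r$ of $D$, with result denoted $\mathcal{G}(D,r)$, is defined as follows: if row $r$ is empty, $\mathcal{G}(D,r)=D$. Otherwise let $c$ be the largest column of a cell in row $r$ (the rightmost cell of the row). If this rightmost cell is a ghost cell, or there is no empty position $(\hat r,c)$ with $\hat r<r$, or, letting $\hat r<r$ be maximal with $(\hat r,c)$ empty, there is a ghost cell $\langle r^*,c\rangle$ with $\hat r<r^*<r$, then $\mathcal{G}(D,r)=D$. Otherwise, with $\hat r<r$ maximal such that $(\hat r,c)$ is empty, $\mathcal{G}(D,r)=(D\setminus\{(r,c)\})\cup\{(\hat r,c),\langle r,c\rangle\}$ (the cell drops to the highest empty position below it in its column and leaves a ghost cell in its old place). $\mathrm{GKD}(D)$ is the set of all diagrams obtainable from $D$ by finite (possibly empty) sequences of ghost moves. The ghost Kohnert poset $\mathcal{P}_G(D)$ has underlying set $\mathrm{GKD}(D)$,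 with $D_2\preceq D_1$ iff $D_2$ can be obtained from $D_1$ by a finite (possibly empty) sequence of ghost moves. A finite poset is ranked if there is $\rho:\mathcal{P}\to\mathbb{Z}_{\ge0}$ with $\rho(x)<\rho(y)$ whenever $x\prec y$ and $\rho(y)=\rho(x)+1$ whenever $y$ covers $x$. -}

module Defs where

open import Data.Nat using (ℕ; zero; suc; _+_; _<_; _≤_)
open import Data.Fin using (Fin) renaming (_<_ to _<ᶠ_)
open import Data.Vec using (Vec; lookup; _[_]≔_; foldr)
open import Data.Product using (_×_; Σ; ∃; _,_)
open import Relation.Binary.PropositionalEquality using (_≡_; _≢_)
open import Relation.Nullary using (¬_)
open import Relation.Binary.Construct.Closure.ReflexiveTransitive using (Star)

data Cell : Set where
  empty ordinary ghost : Cell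

-- A diagram inside the box of n rows and m columns.  Row index i : Fin n
-- stands for row i+1 (counted from the bottom), column j : Fin m for column j+1.
Diagram : ℕ → ℕ → Set
Diagram n m = Vec (Vec Cell m) n

module _ {n m : ℕ} where

  cellAt : Diagram n m → Fin n → Fin m → Cell
  cellAt D r c = lookup (lookup D r) c

  setCell : Diagram n m → Fin n → Fin m → Cell → Diagram n m
  setCell D r c x = D [ r ]≔ (lookup D r [ c ]≔ x)

  record NontrivialGhostMove (D : Diagram n m) (r : Fin n) (D' : Diagram n m) : Set where
    field
      c            : Fin m
      r̂            : Fin n
      rightmost    : ∀ (c' : Fin m) → c <ᶠ c' → cellAt D r c' ≡ empty
      isOrdinary   : cellAt D r c ≡ ordinary
      r̂<r          : r̂ <ᶠ r
      r̂-empty      : cellAt D r̂ c ≡ empty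
      r̂-maximal    : ∀ (r' : Fin n) → r̂ <ᶠ r' → r' <ᶠ r → cellAt D r' c ≢ empty
      noGhostBetween : ∀ (r' : Fin n) → r̂ <ᶠ r' → r' <ᶠ r → cellAt D r' c ≢ ghost
      result       : D' ≡ setCell (setCell D r c ghost) r̂ c ordinary

  -- One ghost move that changes the diagram (in all other cases 𝒢(D,r) = D).
  GhostStep : Diagram n m → Diagram n m → Set
  GhostStep D D' = ∃ λ r → NontrivialGhostMove D r D'

  Reach : Diagram n m → Diagram n m → Set
  Reach = Star GhostStep

  GKD : Diagram n m → Diagram n m → Set
  GKD D T = Reach D T

  _⪯_ : Diagram n m → Diagram n m → Set
  T₂ ⪯ T₁ = Reach T₁ T₂

  countGhostRow : ∀ {k} → Vec Cell k → ℕ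
  countGhostRow = foldr _ (λ { ghost acc → suc acc ; _ acc → acc }) 0

  ghostCount : Diagram n m → ℕ
  ghostCount = foldr _ (λ row acc → countGhostRow row + acc) 0

module _ {A : Set} (P : A → Set) (_≼_ : A → A → Set) where

  _≺_ : A → A → Set
  x ≺ y = x ≼ y × x ≢ y

  Covers : A → A → Set
  Covers x y = x ≺ y × (∀ z → P z → ¬ (x ≺ z × z ≺ y))

  record IsRankFunction (ρ : A → ℕ) : Set where
    field
      strictMono : ∀ x y → P x → P y → x ≺ y → ρ x < ρ y
      coverStep  : ∀ x y → P x → P y → Covers x y → ρ y ≡ suc (ρ x)

  Ranked : Set
  Ranked = Σ (A → ℕ) IsRankFunction

{-# OPTIONS --safe #-}
module Submission where

-- A nontrivial ghost move turns one ordinary cell into a ghost cell and fills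
-- one empty position with an ordinary cell, so it raises |G| by exactly one.
-- Hence |G| strictly increases along every nonempty sequence of moves, and if
-- T₂ is covered by T₁ then the sequence from T₁ to T₂ is a single move (an
-- intermediate diagram would lie strictly between them).  Thus M − |G| drops
-- by one along covers and strictly along ≺.

open import Defs
open import Data.Nat using (ℕ; suc; _+_; _∸_; _≤_; _<_)
open import Data.Nat.Properties
  using (+-assoc; +-comm; +-identityʳ; +-∸-assoc; ∸-monoʳ-<; <-irrefl; <-trans; ≤-refl; ≤-trans; +-commutativeSemigroup)
open import Algebra.Properties.CommutativeSemigroup +-commutativeSemigroup using (xy∙z≈xz∙y)
open import Data.Fin using (zero; suc)
open import Data.Fin.Properties using (<⇒≢)
open import Data.Vec using (Vec; []; _∷_; lookup; _[_]≔_; foldr)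
open import Data.Vec.Properties using (lookup∘update′)
open import Data.Product using (_×_; ∃; _,_)
open import Data.Sum using (_⊎_; inj₁; inj₂)
open import Data.Empty using (⊥-elim)
open import Function using (flip)
open import Relation.Binary.PropositionalEquality
  using (_≡_; _≢_; refl; sym; cong; ≢-sym; module ≡-Reasoning)
open import Relation.Binary.Construct.Closure.ReflexiveTransitive using (Star; ε; _◅_; _◅◅_)

open ≡-Reasoning

sumBy : ∀ {A : Set} {k} → (A → ℕ) → Vec A k → ℕ
sumBy f = foldr _ (λ a acc → f a + acc) 0

sumBy-[]≔ : ∀ {A : Set} {k} (f : A → ℕ) (v : Vec A k) i {y a b} →
  f y + a ≡ f (lookup v i) + b → sumBy f (v [ i ]≔ y) + a ≡ sumBy f v + b
sumBy-[]≔ f (w ∷ ws) zero {y} {a} {b} eq = begin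
  f y + sumBy f ws + a  ≡⟨ xy∙z≈xz∙y (f y) _ a ⟩
  f y + a + sumBy f ws  ≡⟨ cong (_+ sumBy f ws) eq ⟩
  f w + b + sumBy f ws  ≡⟨ xy∙z≈xz∙y (f w) b _ ⟩
  f w + sumBy f ws + b  ∎
sumBy-[]≔ f (w ∷ ws) (suc i) {y} {a} {b} eq = begin
  f w + sumBy f (ws [ i ]≔ y) + a    ≡⟨ +-assoc (f w) _ a ⟩
  f w + (sumBy f (ws [ i ]≔ y) + a)  ≡⟨ cong (f w +_) (sumBy-[]≔ f ws i eq) ⟩
  f w + (sumBy f ws + b)             ≡⟨ sym (+-assoc (f w) _ b) ⟩
  f w + sumBy f ws + b               ∎

ghostWeight : Cell → ℕ
ghostWeight ghost    = 1
ghostWeight empty    = 0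
ghostWeight ordinary = 0

module _ {n m : ℕ} where

  countGhostRow≡sumBy : ∀ {k} (v : Vec Cell k) → countGhostRow {n} {m} v ≡ sumBy ghostWeight v
  countGhostRow≡sumBy []              = refl
  countGhostRow≡sumBy (empty    ∷ v) = countGhostRow≡sumBy v
  countGhostRow≡sumBy (ordinary ∷ v) = countGhostRow≡sumBy v
  countGhostRow≡sumBy (ghost    ∷ v) = cong suc (countGhostRow≡sumBy v)

  countGhostRow-[]≔ : ∀ {k} (v : Vec Cell k) c x →
    countGhostRow {n} {m} (v [ c ]≔ x) + ghostWeight (lookup v c) ≡ countGhostRow {n} {m} v + ghostWeight x
  countGhostRow-[]≔ v c x
    rewrite countGhostRow≡sumBy (v [ c ]≔ x) | countGhostRow≡sumBy v
    = sumBy-[]≔ ghostWeight v c (+-comm (ghostWeight x) _)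

  ghostCount-setCell : ∀ (D : Diagram n m) r c x →
    ghostCount (setCell D r c x) + ghostWeight (cellAt D r c) ≡ ghostCount D + ghostWeight x
  ghostCount-setCell D r c x = sumBy-[]≔ (countGhostRow {n} {m}) D r (countGhostRow-[]≔ (lookup D r) c x)

  ghostCount-overwrite : ∀ (D : Diagram n m) r c x → ghostWeight (cellAt D r c) ≡ 0 →
    ghostCount (setCell D r c x) ≡ ghostCount D + ghostWeight x
  ghostCount-overwrite D r c x old≡0 = begin
    ghostCount (setCell D r c x)                                ≡⟨ sym (+-identityʳ _) ⟩
    ghostCount (setCell D r c x) + 0                            ≡⟨ cong (ghostCount (setCell D r c x) +_) (sym old≡0) ⟩
    ghostCount (setCell D r c x) + ghostWeight (cellAt D r c)   ≡⟨ ghostCount-setCell D r c x ⟩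
    ghostCount D + ghostWeight x                                ∎

  ghostCount-step : ∀ {D D' : Diagram n m} {r} → NontrivialGhostMove D r D' →
    ghostCount D' ≡ suc (ghostCount D)
  ghostCount-step {D} {D'} {r} move = begin
    ghostCount D'                          ≡⟨ cong ghostCount result ⟩
    ghostCount (setCell D₁ r̂ c ordinary)   ≡⟨ ghostCount-overwrite D₁ r̂ c ordinary (cong ghostWeight r̂-still-empty) ⟩
    ghostCount D₁ + 0                      ≡⟨ +-identityʳ _ ⟩
    ghostCount D₁                          ≡⟨ ghostCount-overwrite D r c ghost (cong ghostWeight isOrdinary) ⟩
    ghostCount D + 1                       ≡⟨ +-comm _ 1 ⟩
    suc (ghostCount D)                     ∎
    where
    open NontrivialGhostMove move
    D₁ : Diagram n m
    D₁ = setCell D r c ghost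
    r̂-still-empty : cellAt D₁ r̂ c ≡ empty
    r̂-still-empty = begin
      cellAt D₁ r̂ c                ≡⟨ cong (λ row → lookup row c) (lookup∘update′ (<⇒≢ r̂<r) D _) ⟩
      cellAt D r̂ c                 ≡⟨ r̂-empty ⟩
      empty                        ∎

  ghostCount-ghostStep : ∀ {D D' : Diagram n m} → GhostStep D D' → ghostCount D' ≡ suc (ghostCount D)
  ghostCount-ghostStep (_ , move) = ghostCount-step move

module GradedSteps {A : Set} (Step : A → A → Set) (w : A → ℕ)
                   (w-step : ∀ {x y} → Step x y → w y ≡ suc (w x)) where

  w<-step : ∀ {x y} → Step x y → w x < w y
  w<-step s rewrite w-step s = ≤-refl

  w<⇒≢ : ∀ {x y} → w x < w y → x ≢ y
  w<⇒≢ lt refl = <-irrefl refl lt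

  star⇒≡⊎w< : ∀ {x y} → Star Step x y → x ≡ y ⊎ w x < w y
  star⇒≡⊎w< ε = inj₁ refl
  star⇒≡⊎w< (s ◅ p) with star⇒≡⊎w< p
  ... | inj₁ refl = inj₂ (w<-step s)
  ... | inj₂ lt   = inj₂ (<-trans (w<-step s) lt)

  M∸w-isRankFunction : (P : A → Set) → (∀ {x y} → P x → Step x y → P y) →
    (M : ℕ) → (∀ x → P x → w x ≤ M) → IsRankFunction P (flip (Star Step)) (λ x → M ∸ w x)
  M∸w-isRankFunction P P-closed M bound = record { strictMono = strictMono ; coverStep = coverStep }
    where
    strictMono : ∀ x y → P x → P y → _≺_ P (flip (Star Step)) x y → M ∸ w x < M ∸ w y
    strictMono x y Px _ (y→x , x≢y) with star⇒≡⊎w< y→x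
    ... | inj₁ y≡x = ⊥-elim (x≢y (sym y≡x))
    ... | inj₂ lt  = ∸-monoʳ-< lt (bound x Px)

    coverStep : ∀ x y → P x → P y → Covers P (flip (Star Step)) x y → M ∸ w y ≡ suc (M ∸ w x)
    coverStep x y _  _  ((ε , x≢x) , _) = ⊥-elim (x≢x refl)
    coverStep x y Px Py ((_◅_ {j = z} s z→x , _) , nothing-between) with star⇒≡⊎w< z→x
    ... | inj₁ refl = begin
      M ∸ w y              ≡⟨ +-∸-assoc 1 (≤-trans (w<-step s) (bound z Px)) ⟩
      suc (M ∸ suc (w y))  ≡⟨ cong (λ k → suc (M ∸ k)) (sym (w-step s)) ⟩
      suc (M ∸ w z)        ∎
    ... | inj₂ lt = ⊥-elim (nothing-between z (P-closed Py s)
          ((z→x , ≢-sym (w<⇒≢ lt)) , (s ◅ ε , ≢-sym (w<⇒≢ (w<-step s)))))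

theorem3p2 : ∀ {n m : ℕ} (D : Diagram n m) → ghostCount D ≡ 0 →
    (M : ℕ) → (∃ λ T → GKD D T × ghostCount T ≡ M) →
    (∀ T → GKD D T → ghostCount T ≤ M) →
    Ranked (GKD D) _⪯_ × IsRankFunction (GKD D) _⪯_ (λ T → M ∸ ghostCount T)
theorem3p2 D _ M _ bound = ((λ T → M ∸ ghostCount T) , isRank) , isRank
  where
  open GradedSteps GhostStep ghostCount ghostCount-ghostStep
  isRank : IsRankFunction (GKD D) _⪯_ (λ T → M ∸ ghostCount T)
  isRank = M∸w-isRankFunction (GKD D) (λ D→x s → D→x ◅◅ (s ◅ ε)) M bound
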